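{- Let $\chi$ be a real Dirichlet character and let $\lambda(n)=\sum_{h\mid n}\chi(h)$. Then for all positive integers $d$ and $l$, $$\lambda(l)\lambda(d)\leq \lambda(dl)^2.$$ -}

module Defs where

open import Data.Nat as ℕ using (ℕ; zero; suc; NonZero)
open import Data.Nat.Divisibility using (_∣_; _∣?_)
open import Data.Nat.GCD using (gcd)
open import Data.Integer as ℤ using (ℤ; +_; -[1+_])
open import Data.List using (List; filter; map; foldr; upTo)
open import Data.Product using (_×_)
open import Data.Sum using (_⊎_)
open import Relation.Binary.PropositionalEquality using (_≡_; _≢_)

record RealDirichletCharacter (q : ℕ) .{{_ : NonZero q}} : Set where
  field
    χ          : ℕ → ℤ
    real       : ∀ n → (χ n ≡ + 0) ⊎ ((χ n ≡ + 1) ⊎ (χ n ≡ -[1+ 0 ]))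
    one        : χ 1 ≡ + 1
    mult       : ∀ m n → χ (m ℕ.* n) ≡ χ m ℤ.* χ n
    periodic   : ∀ n → χ (n ℕ.+ q) ≡ χ n
    zero-iff   : ∀ n → (χ n ≡ + 0 → gcd n q ≢ 1) × (gcd n q ≢ 1 → χ n ≡ + 0)

divisors : ℕ → List ℕ
divisors n = filter (_∣? n) (map suc (upTo n))

lam : (ℕ → ℤ) → ℕ → ℤ
lam χ n = foldr ℤ._+_ (+ 0) (map χ (divisors n))

-- Write Λ(n) = ∑_{h ∣ n} χ(h).  For a prime p, the divisors of p·n are the divisors
-- of n prime to p together with the multiples p·k of the divisors k of n, so
-- Λ(p·n) = ∑_{h ∣ n, p ∤ h} χ(h) + χ(p)·Λ(n); for n = p^a·m with p ∤ m the first sum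
-- is Λ(m), whence Λ(p^a·m) = (1 + χ(p) + ⋯ + χ(p)^a)·Λ(m).  Since χ(p) ∈ {-1, 0, 1},
-- these geometric sums G(a) are non-negative and satisfy G(a)·G(b) ≤ G(a+b)².  So
-- Λ ≥ 0, and pulling the powers of a prime p dividing d·l out of d and l reduces the
-- inequality for (d, l) to the inequality for their p-free parts, which have a smaller
-- product.
module Submission where

open import Defs
open import Data.Nat as ℕ using (ℕ; zero; suc; NonZero; z≤n; s≤s)
open import Data.Integer as ℤ using (ℤ; _+_; _*_; _≤_; 0ℤ; 1ℤ; -1ℤ; +≤+)
import Data.Nat.Properties as ℕₚ
import Data.Integer.Properties as ℤₚ
open import Data.Integer.Tactic.RingSolver using (solve-∀)
open import Data.Nat.Divisibility
  using (_∣_; _∤_; _∣?_; divides; _∣0; ∣-refl; ∣-trans; n∣m*n; m∣m*n; *-monoʳ-∣; *-cancelˡ-∣;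
         ∣m+n∣m⇒∣n; >⇒∤)
open import Data.Nat.Coprimality using (Coprime; coprime-divisor)
open import Data.Nat.Primality
  using (Prime; prime⇒irreducible; prime⇒nonZero; prime⇒nonTrivial; euclidsLemma)
open import Data.Nat.Primality.Factorisation using (factorise; PrimeFactorisation)
open import Data.Nat.ListAction using (product)
open import Data.Nat.Induction using (<-wellFounded)
open import Induction.WellFounded using (Acc; acc)
open import Data.List using (_∷_; []; _∷ʳ_; map; filter; foldr; upTo; applyUpTo)
import Data.List.Properties as Listₚ
open import Data.List.Relation.Unary.All using (All; _∷_)
import Algebra.Properties.CommutativeSemigroup as CommutativeSemigroupProperties
open import Data.Bool using (if_then_else_)
open import Data.Product using (_×_; _,_; ∃; ∃₂)
open import Data.Sum using (_⊎_; inj₁; inj₂)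
open import Function using (_∘_; id)
open import Level using (Level)
open import Relation.Nullary using (does; yes; no; ¬_; contradiction)
open import Relation.Unary using (Pred; Decidable)
open import Relation.Unary.Properties using (∁?)
open import Relation.Binary.PropositionalEquality
  using (_≡_; _≢_; _≗_; refl; sym; trans; cong; cong₂; subst; subst₂; module ≡-Reasoning)

private
  variable
    ℓ ℓ′ : Level
    P : Pred ℕ ℓ
    Q : Pred ℕ ℓ′
    f g : ℕ → ℤ
    m n x y : ℕ

  ℤ-+-interchange : ∀ a b c d → (a + b) + (c + d) ≡ (a + c) + (b + d)
  ℤ-+-interchange = CommutativeSemigroupProperties.interchange ℤₚ.+-commutativeSemigroup

  ℤ-*-interchange : ∀ a b c d → (a * b) * (c * d) ≡ (a * c) * (b * d)
  ℤ-*-interchange = CommutativeSemigroupProperties.interchange ℤₚ.*-commutativeSemigroup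

  ℕ-*-interchange : ∀ a b c d → (a ℕ.* b) ℕ.* (c ℕ.* d) ≡ (a ℕ.* c) ℕ.* (b ℕ.* d)
  ℕ-*-interchange = CommutativeSemigroupProperties.interchange ℕₚ.*-commutativeSemigroup

sumTo : ℕ → (ℕ → ℤ) → ℤ
sumTo zero    f = 0ℤ
sumTo (suc n) f = sumTo n f + f (suc n)

sumTo-cong : f ≗ g → ∀ n → sumTo n f ≡ sumTo n g
sumTo-cong f≗g zero    = refl
sumTo-cong f≗g (suc n) = cong₂ _+_ (sumTo-cong f≗g n) (f≗g (suc n))

sumTo-zero : ∀ n → (∀ i → 0 ℕ.< i → i ℕ.≤ n → f i ≡ 0ℤ) → sumTo n f ≡ 0ℤ
sumTo-zero zero    vanish = refl
sumTo-zero (suc n) vanish =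
  cong₂ _+_ (sumTo-zero n (λ i 0<i i≤n → vanish i 0<i (ℕₚ.m≤n⇒m≤1+n i≤n)))
            (vanish (suc n) (s≤s z≤n) ℕₚ.≤-refl)

sumTo-+ : ∀ n → sumTo n (λ i → f i + g i) ≡ sumTo n f + sumTo n g
sumTo-+ zero    = refl
sumTo-+ {f} {g} (suc n) = trans (cong (_+ (f (suc n) + g (suc n))) (sumTo-+ n))
                                (ℤ-+-interchange (sumTo n f) (sumTo n g) (f (suc n)) (g (suc n)))

sumTo-*ˡ : ∀ c n → sumTo n (λ i → c * f i) ≡ c * sumTo n f
sumTo-*ˡ c zero    = sym (ℤₚ.*-zeroʳ c)
sumTo-*ˡ {f} c (suc n) = trans (cong (_+ c * f (suc n)) (sumTo-*ˡ c n))
                               (sym (ℤₚ.*-distribˡ-+ c (sumTo n f) (f (suc n))))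

sumTo-+-split : ∀ m n → sumTo (m ℕ.+ n) f ≡ sumTo n f + sumTo m (λ i → f (i ℕ.+ n))
sumTo-+-split zero    n = sym (ℤₚ.+-identityʳ _)
sumTo-+-split {f} (suc m) n = trans (cong (_+ f (suc m ℕ.+ n)) (sumTo-+-split m n))
                                    (ℤₚ.+-assoc (sumTo n f) _ _)

sumTo-extend : ∀ k n → (∀ i → n ℕ.< i → f i ≡ 0ℤ) → sumTo (k ℕ.+ n) f ≡ sumTo n f
sumTo-extend {f} k n vanish = begin
  sumTo (k ℕ.+ n) f                        ≡⟨ sumTo-+-split k n ⟩
  sumTo n f + sumTo k (λ i → f (i ℕ.+ n))  ≡⟨ cong (sumTo n f +_) tail≡0 ⟩
  sumTo n f + 0ℤ                           ≡⟨ ℤₚ.+-identityʳ _ ⟩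
  sumTo n f                                ∎
  where
  open ≡-Reasoning
  tail≡0 : sumTo k (λ i → f (i ℕ.+ n)) ≡ 0ℤ
  tail≡0 = sumTo-zero k (λ i 0<i _ → vanish (i ℕ.+ n) (ℕₚ.m<n+m n 0<i))

sumTo-multiples : ∀ p .{{_ : NonZero p}} → (∀ i → p ∤ i → g i ≡ 0ℤ) →
                  ∀ n → sumTo (p ℕ.* n) g ≡ sumTo n (g ∘ (p ℕ.*_))
sumTo-multiples {g} p vanish zero = cong (λ k → sumTo k g) (ℕₚ.*-zeroʳ p)
sumTo-multiples {g} p@(suc p′) vanish (suc n) = begin
  sumTo (p ℕ.* suc n) g
    ≡⟨ cong (λ k → sumTo k g) (ℕₚ.*-suc p n) ⟩
  sumTo (p ℕ.+ p ℕ.* n) g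
    ≡⟨ sumTo-+-split p (p ℕ.* n) ⟩
  sumTo (p ℕ.* n) g + (between + g (p ℕ.+ p ℕ.* n))
    ≡⟨ cong₂ (λ s t → s + (t + g (p ℕ.+ p ℕ.* n))) (sumTo-multiples p vanish n) between≡0 ⟩
  sumTo n (g ∘ (p ℕ.*_)) + (0ℤ + g (p ℕ.+ p ℕ.* n))
    ≡⟨ cong (sumTo n (g ∘ (p ℕ.*_)) +_) (ℤₚ.+-identityˡ _) ⟩
  sumTo n (g ∘ (p ℕ.*_)) + g (p ℕ.+ p ℕ.* n)
    ≡⟨ cong (λ k → sumTo n (g ∘ (p ℕ.*_)) + g k) (ℕₚ.*-suc p n) ⟨
  sumTo n (g ∘ (p ℕ.*_)) + g (p ℕ.* suc n)
    ∎
  where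
  open ≡-Reasoning
  between : ℤ
  between = sumTo p′ (λ i → g (i ℕ.+ p ℕ.* n))
  between≡0 : between ≡ 0ℤ
  between≡0 = sumTo-zero p′ λ i 0<i i≤p′ → vanish (i ℕ.+ p ℕ.* n) λ p∣i+pn →
    >⇒∤ {{ℕ.>-nonZero 0<i}} (s≤s i≤p′)
        (∣m+n∣m⇒∣n (subst (p ∣_) (ℕₚ.+-comm i (p ℕ.* n)) p∣i+pn) (m∣m*n n))

foldr-+-∷ʳ : ∀ xs z → foldr _+_ 0ℤ (xs ∷ʳ z) ≡ foldr _+_ 0ℤ xs + z
foldr-+-∷ʳ []       z = trans (ℤₚ.+-identityʳ z) (sym (ℤₚ.+-identityˡ z))
foldr-+-∷ʳ (x ∷ xs) z = trans (cong (x +_) (foldr-+-∷ʳ xs z)) (sym (ℤₚ.+-assoc x _ z))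

foldr-+-applyUpTo : ∀ n → foldr _+_ 0ℤ (applyUpTo (f ∘ suc) n) ≡ sumTo n f
foldr-+-applyUpTo zero    = refl
foldr-+-applyUpTo {f} (suc n) = begin
  foldr _+_ 0ℤ (applyUpTo (f ∘ suc) (suc n))
    ≡⟨ cong (foldr _+_ 0ℤ) (Listₚ.applyUpTo-∷ʳ (f ∘ suc) n) ⟨
  foldr _+_ 0ℤ (applyUpTo (f ∘ suc) n ∷ʳ f (suc n))
    ≡⟨ foldr-+-∷ʳ (applyUpTo (f ∘ suc) n) (f (suc n)) ⟩
  foldr _+_ 0ℤ (applyUpTo (f ∘ suc) n) + f (suc n)
    ≡⟨ cong (_+ f (suc n)) (foldr-+-applyUpTo n) ⟩
  sumTo (suc n) f
    ∎
  where open ≡-Reasoning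

-- restrict P? f = f·𝟙_P.  It is opaque so that unification sees 'restrict P? f x'
-- as a whole and can recover f and x from it.

opaque
  restrict : Decidable P → (ℕ → ℤ) → ℕ → ℤ
  restrict P? f x = if does (P? x) then f x else 0ℤ

opaque
  unfolding restrict

  restrict-yes : (P? : Decidable P) → P x → restrict P? f x ≡ f x
  restrict-yes {x = x} P? Px with P? x
  ... | yes _  = refl
  ... | no ¬Px = contradiction Px ¬Px

  restrict-no : (P? : Decidable P) → ¬ P x → restrict P? f x ≡ 0ℤ
  restrict-no {x = x} P? ¬Px with P? x
  ... | yes Px = contradiction Px ¬Px
  ... | no _   = refl

  restrict-zero : (P? : Decidable P) → f x ≡ 0ℤ → restrict P? f x ≡ 0ℤ
  restrict-zero {x = x} P? fx≡0 with P? x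
  ... | yes _ = fx≡0
  ... | no _  = refl

  restrict-*ˡ : (P? : Decidable P) → ∀ c → restrict P? (λ y → c * f y) x ≡ c * restrict P? f x
  restrict-*ˡ {x = x} P? c with P? x
  ... | yes _ = refl
  ... | no _  = sym (ℤₚ.*-zeroʳ c)

  restrict-⇔ : (P? : Decidable P) (Q? : Decidable Q) → (P x → Q y) → (Q y → P x) → f x ≡ g y →
               restrict P? f x ≡ restrict Q? g y
  restrict-⇔ {x = x} {y = y} P? Q? P⇒Q Q⇒P fx≡gy with P? x | Q? y
  ... | yes _  | yes _  = fx≡gy
  ... | yes Px | no ¬Qy = contradiction (P⇒Q Px) ¬Qy
  ... | no ¬Px | yes Qy = contradiction (Q⇒P Qy) ¬Px
  ... | no _   | no _   = refl

  restrict-under : (P? : Decidable P) (Q? : Decidable Q) → (P x → Q x) →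
                   restrict P? (restrict Q? f) x ≡ restrict P? f x
  restrict-under {x = x} {f = f} P? Q? P⇒Q with P? x
  ... | yes Px = restrict-yes {f = f} Q? (P⇒Q Px)
  ... | no _   = refl

  restrict-split : (P? : Decidable P) (Q? : Decidable Q) →
                   restrict P? f x ≡ restrict P? (restrict (∁? Q?) f) x + restrict P? (restrict Q? f) x
  restrict-split {f = f} {x = x} P? Q? with P? x | Q? x
  ... | yes _ | yes _ = sym (ℤₚ.+-identityˡ (f x))
  ... | yes _ | no _  = sym (ℤₚ.+-identityʳ (f x))
  ... | no _  | _     = refl

divisorSum : (ℕ → ℤ) → ℕ → ℤ
divisorSum f n = sumTo n (restrict (_∣? n) f)

lam≡divisorSum : ∀ f n → lam f n ≡ divisorSum f n
lam≡divisorSum f n = begin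
  foldr _+_ 0ℤ (map f (filter (_∣? n) (map suc (upTo n))))  ≡⟨ foldr-+-filter (map suc (upTo n)) ⟩
  foldr _+_ 0ℤ (map f′ (map suc (upTo n)))                  ≡⟨ cong (foldr _+_ 0ℤ) map-range ⟩
  foldr _+_ 0ℤ (applyUpTo (f′ ∘ suc) n)                     ≡⟨ foldr-+-applyUpTo n ⟩
  sumTo n f′                                                ∎
  where
  open ≡-Reasoning
  f′ : ℕ → ℤ
  f′ = restrict (_∣? n) f
  foldr-+-filter : ∀ xs → foldr _+_ 0ℤ (map f (filter (_∣? n) xs)) ≡ foldr _+_ 0ℤ (map f′ xs)
  foldr-+-filter []       = refl
  foldr-+-filter (x ∷ xs) with x ∣? n
  ... | yes x∣n = cong₂ _+_ (sym (restrict-yes (_∣? n) x∣n)) (foldr-+-filter xs)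
  ... | no x∤n  = trans (foldr-+-filter xs)
                        (sym (trans (cong (_+ _) (restrict-no (_∣? n) x∤n)) (ℤₚ.+-identityˡ _)))
  map-range : map f′ (map suc (upTo n)) ≡ applyUpTo (f′ ∘ suc) n
  map-range = trans (cong (map f′) (Listₚ.map-upTo suc n)) (Listₚ.map-applyUpTo suc f′ n)

divisorSum-cong : f ≗ g → ∀ n → divisorSum f n ≡ divisorSum g n
divisorSum-cong f≗g n = sumTo-cong (λ h → restrict-⇔ (_∣? n) (_∣? n) id id (f≗g h)) n

divisorSum-*ˡ : ∀ c n → divisorSum (λ h → c * f h) n ≡ c * divisorSum f n
divisorSum-*ˡ c n = trans (sumTo-cong (λ h → restrict-*ˡ (_∣? n) c) n) (sumTo-*ˡ c n)

divisorSum-split : (Q? : Decidable Q) →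
                   ∀ n → divisorSum f n ≡ divisorSum (restrict (∁? Q?) f) n + divisorSum (restrict Q? f) n
divisorSum-split Q? n = trans (sumTo-cong (λ h → restrict-split (_∣? n) Q?) n) (sumTo-+ n)

divisorSum-multiples : ∀ p .{{_ : NonZero p}} n →
                       divisorSum (restrict (p ∣?_) f) (p ℕ.* n) ≡ divisorSum (f ∘ (p ℕ.*_)) n
divisorSum-multiples {f} p n = trans (sumTo-multiples p off-multiples n) (sumTo-cong on-multiples n)
  where
  off-multiples : ∀ i → p ∤ i → restrict (_∣? p ℕ.* n) (restrict (p ∣?_) f) i ≡ 0ℤ
  off-multiples i p∤i = restrict-zero (_∣? p ℕ.* n) (restrict-no (p ∣?_) p∤i)
  on-multiples : ∀ k → restrict (_∣? p ℕ.* n) (restrict (p ∣?_) f) (p ℕ.* k) ≡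
                       restrict (_∣? n) (f ∘ (p ℕ.*_)) k
  on-multiples k = restrict-⇔ (_∣? p ℕ.* n) (_∣? n) (*-cancelˡ-∣ p) (*-monoʳ-∣ p)
                              (restrict-yes (p ∣?_) (m∣m*n k))

restrict∤ : ℕ → (ℕ → ℤ) → ℕ → ℤ
restrict∤ p = restrict (∁? (p ∣?_))

∤⇒nonZero : ∀ {p} → p ∤ n → NonZero n
∤⇒nonZero {zero}  {p} p∤0 = contradiction (p ∣0) p∤0
∤⇒nonZero {suc n} _       = _

∃-prime-∣ : ∀ n .{{_ : NonZero n}} → n ≢ 1 → ∃ λ p → Prime p × p ∣ n
∃-prime-∣ n n≢1 = first-factor (PrimeFactorisation.factors F) (PrimeFactorisation.isFactorisation F)
                               (PrimeFactorisation.factorsPrime F)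
  where
  F : PrimeFactorisation n
  F = factorise n
  first-factor : ∀ ps → n ≡ product ps → All Prime ps → ∃ λ p → Prime p × p ∣ n
  first-factor []       n≡1      _             = contradiction n≡1 n≢1
  first-factor (p ∷ ps) n≡p*Πps (p-prime ∷ _) = p , p-prime , subst (p ∣_) (sym n≡p*Πps) (m∣m*n _)

p^a*m*[p^b*n]≡p^[a+b]*[m*n] : ∀ p a b m n →
                              p ℕ.^ a ℕ.* m ℕ.* (p ℕ.^ b ℕ.* n) ≡ p ℕ.^ (a ℕ.+ b) ℕ.* (m ℕ.* n)
p^a*m*[p^b*n]≡p^[a+b]*[m*n] p a b m n =
  trans (ℕ-*-interchange (p ℕ.^ a) m (p ℕ.^ b) n)
        (cong (ℕ._* (m ℕ.* n)) (sym (ℕₚ.^-distribˡ-+-* p a b)))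

module _ {p} (p-prime : Prime p) where

  private instance
    p≢0 : NonZero p
    p≢0 = prime⇒nonZero p-prime

  1<p : 1 ℕ.< p
  1<p = ℕ.nonTrivial⇒n>1 p {{prime⇒nonTrivial p-prime}}

  ∤-prime⇒coprime : p ∤ m → Coprime m p
  ∤-prime⇒coprime p∤m (e∣m , e∣p) with prime⇒irreducible p-prime e∣p
  ... | inj₁ e≡1  = e≡1
  ... | inj₂ refl = contradiction e∣m p∤m

  ∤-prime-* : p ∤ m → p ∤ n → p ∤ m ℕ.* n
  ∤-prime-* {m} {n} p∤m p∤n p∣mn with euclidsLemma m n p-prime p∣mn
  ... | inj₁ p∣m = p∤m p∣m
  ... | inj₂ p∣n = p∤n p∣n

  prime-power-split : ∀ n .{{_ : NonZero n}} → ∃₂ λ a m → p ∤ m × n ≡ p ℕ.^ a ℕ.* m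
  prime-power-split n = go n (<-wellFounded n)
    where
    go : ∀ n .{{_ : NonZero n}} → Acc ℕ._<_ n → ∃₂ λ a m → p ∤ m × n ≡ p ℕ.^ a ℕ.* m
    go n (acc rec) with p ∣? n
    ... | no p∤n = 0 , n , p∤n , sym (ℕₚ.*-identityˡ n)
    go (suc _) _   | yes (divides zero ())
    go n (acc rec) | yes (divides q@(suc _) n≡q*p) =
      let a , m , p∤m , q≡p^a*m = go q (rec (subst (q ℕ.<_) (sym n≡q*p) (ℕₚ.m<m*n q p 1<p)))
      in  suc a , m , p∤m , (begin
            n                      ≡⟨ n≡q*p ⟩
            q ℕ.* p                ≡⟨ ℕₚ.*-comm q p ⟩
            p ℕ.* q                ≡⟨ cong (p ℕ.*_) q≡p^a*m ⟩
            p ℕ.* (p ℕ.^ a ℕ.* m)  ≡⟨ ℕₚ.*-assoc p (p ℕ.^ a) m ⟨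
            p ℕ.^ suc a ℕ.* m      ∎)
      where open ≡-Reasoning

  <-prime-power-* : ∀ a .{{_ : NonZero m}} → p ∤ m → p ∣ p ℕ.^ a ℕ.* m → m ℕ.< p ℕ.^ a ℕ.* m
  <-prime-power-* {m} zero    p∤m p∣m = contradiction (subst (p ∣_) (ℕₚ.*-identityˡ m) p∣m) p∤m
  <-prime-power-* {m} (suc a) _   _   =
    subst (m ℕ.<_) (ℕₚ.*-comm m (p ℕ.^ suc a)) (ℕₚ.m<m*n m (p ℕ.^ suc a) 1<p^[1+a])
    where
    1<p^[1+a] : 1 ℕ.< p ℕ.^ suc a
    1<p^[1+a] = ℕₚ.<-≤-trans 1<p (ℕₚ.m≤m*n p (p ℕ.^ a) {{ℕₚ.m^n≢0 p a}})

  divisorSum-∤-prime-* : ∀ n .{{_ : NonZero n}} →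
                         divisorSum (restrict∤ p f) (p ℕ.* n) ≡ divisorSum (restrict∤ p f) n
  divisorSum-∤-prime-* {f} n = begin
    sumTo (p ℕ.* n) (restrict (_∣? p ℕ.* n) f′)
      ≡⟨ sumTo-cong same-terms (p ℕ.* n) ⟩
    sumTo (p ℕ.* n) (restrict (_∣? n) f′)
      ≡⟨ cong (λ k → sumTo k (restrict (_∣? n) f′)) p*n≡p′*n+n ⟩
    sumTo (p′ ℕ.* n ℕ.+ n) (restrict (_∣? n) f′)
      ≡⟨ sumTo-extend (p′ ℕ.* n) n (λ i n<i → restrict-no (_∣? n) (>⇒∤ n<i)) ⟩
    sumTo n (restrict (_∣? n) f′)
      ∎
    where
    open ≡-Reasoning
    f′ : ℕ → ℤ
    f′ = restrict∤ p f
    p′ : ℕ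
    p′ = ℕ.pred p
    p*n≡p′*n+n : p ℕ.* n ≡ p′ ℕ.* n ℕ.+ n
    p*n≡p′*n+n = trans (cong (ℕ._* n) (sym (ℕₚ.suc-pred p))) (ℕₚ.+-comm n (p′ ℕ.* n))
    same-terms : restrict (_∣? p ℕ.* n) f′ ≗ restrict (_∣? n) f′
    same-terms h with p ∣? h
    ... | yes p∣h = trans (restrict-zero (_∣? p ℕ.* n) f′h≡0) (sym (restrict-zero (_∣? n) f′h≡0))
      where
      f′h≡0 : f′ h ≡ 0ℤ
      f′h≡0 = restrict-no (∁? (p ∣?_)) (contradiction p∣h)
    ... | no p∤h  = restrict-⇔ (_∣? p ℕ.* n) (_∣? n) (coprime-divisor (∤-prime⇒coprime p∤h))
                               (λ h∣n → ∣-trans h∣n (n∣m*n p)) refl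

  divisorSum-∤-prime-^ : ∀ a n .{{_ : NonZero n}} →
                         divisorSum (restrict∤ p f) (p ℕ.^ a ℕ.* n) ≡ divisorSum (restrict∤ p f) n
  divisorSum-∤-prime-^ zero    n = cong (divisorSum _) (ℕₚ.*-identityˡ n)
  divisorSum-∤-prime-^ (suc a) n = begin
    divisorSum _ (p ℕ.^ suc a ℕ.* n)      ≡⟨ cong (divisorSum _) (ℕₚ.*-assoc p (p ℕ.^ a) n) ⟩
    divisorSum _ (p ℕ.* (p ℕ.^ a ℕ.* n))  ≡⟨ divisorSum-∤-prime-* (p ℕ.^ a ℕ.* n) {{p^a*n≢0}} ⟩
    divisorSum _ (p ℕ.^ a ℕ.* n)          ≡⟨ divisorSum-∤-prime-^ a n ⟩
    divisorSum _ n                        ∎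
    where
    open ≡-Reasoning
    p^a*n≢0 : NonZero (p ℕ.^ a ℕ.* n)
    p^a*n≢0 = ℕₚ.m*n≢0 (p ℕ.^ a) n {{ℕₚ.m^n≢0 p a}}

  divisorSum-∤-prime : ∀ n → p ∤ n → divisorSum (restrict∤ p f) n ≡ divisorSum f n
  divisorSum-∤-prime n p∤n =
    sumTo-cong (λ h → restrict-under (_∣? n) (∁? (p ∣?_)) (λ h∣n p∣h → p∤n (∣-trans p∣h h∣n))) n

  divisorSum-prime-* : ∀ n .{{_ : NonZero n}} →
                       divisorSum f (p ℕ.* n) ≡ divisorSum (restrict∤ p f) n + divisorSum (f ∘ (p ℕ.*_)) n
  divisorSum-prime-* {f} n =
    trans (divisorSum-split (p ∣?_) (p ℕ.* n))
          (cong₂ _+_ (divisorSum-∤-prime-* n) (divisorSum-multiples p n))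

IsSign : ℤ → Set
IsSign x = x ≡ 0ℤ ⊎ (x ≡ 1ℤ ⊎ x ≡ -1ℤ)

geometricSum : ℤ → ℕ → ℤ
geometricSum x zero    = 1ℤ
geometricSum x (suc a) = 1ℤ + x * geometricSum x a

geometricSum-0 : ∀ a → geometricSum 0ℤ a ≡ 1ℤ
geometricSum-0 zero    = refl
geometricSum-0 (suc a) = refl

geometricSum-1 : ∀ a → geometricSum 1ℤ a ≡ ℤ.+ suc a
geometricSum-1 zero    = refl
geometricSum-1 (suc a) =
  trans (cong (λ s → 1ℤ + 1ℤ * s) (geometricSum-1 a)) (cong (1ℤ +_) (ℤₚ.*-identityˡ (ℤ.+ suc a)))

geometricSum-−1-periodic : ∀ a → geometricSum -1ℤ (2 ℕ.+ a) ≡ geometricSum -1ℤ a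
geometricSum-−1-periodic a = cancel (geometricSum -1ℤ a)
  where
  cancel : ∀ s → 1ℤ + -1ℤ * (1ℤ + -1ℤ * s) ≡ s
  cancel = solve-∀

geometricSum-−1-idem : ∀ a → geometricSum -1ℤ a * geometricSum -1ℤ a ≡ geometricSum -1ℤ a
geometricSum-−1-idem zero          = refl
geometricSum-−1-idem (suc zero)    = refl
geometricSum-−1-idem (suc (suc a)) rewrite geometricSum-−1-periodic a = geometricSum-−1-idem a

geometricSum-−1-nonNeg : ∀ a → 0ℤ ≤ geometricSum -1ℤ a
geometricSum-−1-nonNeg zero          = +≤+ z≤n
geometricSum-−1-nonNeg (suc zero)    = +≤+ z≤n
geometricSum-−1-nonNeg (suc (suc a)) rewrite geometricSum-−1-periodic a = geometricSum-−1-nonNeg a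

geometricSum-−1-*-≤ : ∀ a b → geometricSum -1ℤ a * geometricSum -1ℤ b ≤
                              geometricSum -1ℤ (a ℕ.+ b) * geometricSum -1ℤ (a ℕ.+ b)
geometricSum-−1-*-≤ zero          b rewrite geometricSum-−1-idem b = ℤₚ.≤-reflexive (ℤₚ.*-identityˡ _)
geometricSum-−1-*-≤ (suc zero)    b rewrite geometricSum-−1-idem (suc b) = geometricSum-−1-nonNeg (suc b)
geometricSum-−1-*-≤ (suc (suc a)) b
  rewrite geometricSum-−1-periodic a | geometricSum-−1-periodic (a ℕ.+ b) = geometricSum-−1-*-≤ a b

geometricSum-nonNeg : ∀ {x} → IsSign x → ∀ a → 0ℤ ≤ geometricSum x a
geometricSum-nonNeg (inj₁ refl)        a = subst (0ℤ ≤_) (sym (geometricSum-0 a)) (+≤+ z≤n)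
geometricSum-nonNeg (inj₂ (inj₁ refl)) a = subst (0ℤ ≤_) (sym (geometricSum-1 a)) (+≤+ z≤n)
geometricSum-nonNeg (inj₂ (inj₂ refl)) a = geometricSum-−1-nonNeg a

geometricSum-*-≤ : ∀ {x} → IsSign x → ∀ a b →
                   geometricSum x a * geometricSum x b ≤ geometricSum x (a ℕ.+ b) * geometricSum x (a ℕ.+ b)
geometricSum-*-≤ (inj₁ refl) a b
  rewrite geometricSum-0 a | geometricSum-0 b | geometricSum-0 (a ℕ.+ b) = ℤₚ.≤-refl
geometricSum-*-≤ (inj₂ (inj₁ refl)) a b
  rewrite geometricSum-1 a | geometricSum-1 b | geometricSum-1 (a ℕ.+ b) =
  +≤+ (ℕₚ.*-mono-≤ (s≤s (ℕₚ.m≤m+n a b)) (s≤s (ℕₚ.m≤n+m b a)))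
geometricSum-*-≤ (inj₂ (inj₂ refl)) = geometricSum-−1-*-≤

*-nonNeg : ∀ {i j} → 0ℤ ≤ i → 0ℤ ≤ j → 0ℤ ≤ i * j
*-nonNeg {ℤ.+ m} {ℤ.+ n} _ _ = subst (0ℤ ≤_) (ℤₚ.pos-* m n) (+≤+ z≤n)

*-mono-≤-nonNeg : ∀ {i j k l} → i ≤ j → k ≤ l → 0ℤ ≤ j → 0ℤ ≤ k → i * k ≤ j * l
*-mono-≤-nonNeg {i} {j} {k} i≤j k≤l 0≤j 0≤k =
  ℤₚ.≤-trans (ℤₚ.*-monoʳ-≤-nonNeg k {{ℤ.nonNegative 0≤k}} i≤j)
             (ℤₚ.*-monoˡ-≤-nonNeg j {{ℤ.nonNegative 0≤j}} k≤l)

module _ (χ : ℕ → ℤ) (χ-* : ∀ m n → χ (m ℕ.* n) ≡ χ m * χ n) where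

  Λ : ℕ → ℤ
  Λ = divisorSum χ

  Λ-prime-power-* : ∀ {p} → Prime p → p ∤ m →
                    ∀ a → Λ (p ℕ.^ a ℕ.* m) ≡ geometricSum (χ p) a * Λ m
  Λ-prime-power-* {m} p-prime p∤m zero =
    trans (cong Λ (ℕₚ.*-identityˡ m)) (sym (ℤₚ.*-identityˡ (Λ m)))
  Λ-prime-power-* {m} {p} p-prime p∤m (suc a) = begin
    Λ (p ℕ.^ suc a ℕ.* m)
      ≡⟨ cong Λ (ℕₚ.*-assoc p (p ℕ.^ a) m) ⟩
    Λ (p ℕ.* (p ℕ.^ a ℕ.* m))
      ≡⟨ divisorSum-prime-* p-prime (p ℕ.^ a ℕ.* m) ⟩
    divisorSum (restrict∤ p χ) (p ℕ.^ a ℕ.* m) + divisorSum (χ ∘ (p ℕ.*_)) (p ℕ.^ a ℕ.* m)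
      ≡⟨ cong₂ _+_ p-free-part multiples-part ⟩
    Λ m + χ p * (geometricSum (χ p) a * Λ m)
      ≡⟨ horner (χ p) (geometricSum (χ p) a) (Λ m) ⟩
    geometricSum (χ p) (suc a) * Λ m
      ∎
    where
    open ≡-Reasoning
    instance
      m≢0 : NonZero m
      m≢0 = ∤⇒nonZero p∤m
      p^a*m≢0 : NonZero (p ℕ.^ a ℕ.* m)
      p^a*m≢0 = ℕₚ.m*n≢0 (p ℕ.^ a) m {{ℕₚ.m^n≢0 p a {{prime⇒nonZero p-prime}}}}
    p-free-part : divisorSum (restrict∤ p χ) (p ℕ.^ a ℕ.* m) ≡ Λ m
    p-free-part = trans (divisorSum-∤-prime-^ p-prime a m) (divisorSum-∤-prime p-prime m p∤m)
    multiples-part : divisorSum (χ ∘ (p ℕ.*_)) (p ℕ.^ a ℕ.* m) ≡ χ p * (geometricSum (χ p) a * Λ m)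
    multiples-part = begin
      divisorSum (χ ∘ (p ℕ.*_)) (p ℕ.^ a ℕ.* m)     ≡⟨ divisorSum-cong (χ-* p) (p ℕ.^ a ℕ.* m) ⟩
      divisorSum (λ h → χ p * χ h) (p ℕ.^ a ℕ.* m)  ≡⟨ divisorSum-*ˡ (χ p) (p ℕ.^ a ℕ.* m) ⟩
      χ p * Λ (p ℕ.^ a ℕ.* m)                       ≡⟨ cong (χ p *_) (Λ-prime-power-* p-prime p∤m a) ⟩
      χ p * (geometricSum (χ p) a * Λ m)            ∎
    horner : ∀ x s t → t + x * (s * t) ≡ (1ℤ + x * s) * t
    horner = solve-∀

  module _ (χ-1 : χ 1 ≡ 1ℤ) (χ-sign : ∀ n → IsSign (χ n)) where

    Λ-1 : Λ 1 ≡ 1ℤ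
    Λ-1 = trans (ℤₚ.+-identityˡ _) (trans (restrict-yes (_∣? 1) ∣-refl) χ-1)

    Λ-nonNeg : ∀ n .{{_ : NonZero n}} → 0ℤ ≤ Λ n
    Λ-nonNeg n = go n (<-wellFounded n)
      where
      go : ∀ n .{{_ : NonZero n}} → Acc ℕ._<_ n → 0ℤ ≤ Λ n
      go n (acc rec) with n ℕ.≟ 1
      ... | yes refl = subst (0ℤ ≤_) (sym Λ-1) (+≤+ z≤n)
      ... | no n≢1 with ∃-prime-∣ n n≢1
      ... | p , p-prime , p∣n with prime-power-split p-prime n
      ... | a , m , p∤m , refl =
        subst (0ℤ ≤_) (sym (Λ-prime-power-* p-prime p∤m a))
              (*-nonNeg (geometricSum-nonNeg (χ-sign p) a) (go m (rec (<-prime-power-* p-prime a p∤m p∣n))))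
        where
        instance
          m≢0 : NonZero m
          m≢0 = ∤⇒nonZero p∤m

    Λ-*-≤-prime-power : ∀ {p d l} → Prime p → p ∤ d → p ∤ l →
                        Λ l * Λ d ≤ Λ (d ℕ.* l) * Λ (d ℕ.* l) →
                        ∀ a b → let D = p ℕ.^ a ℕ.* d; L = p ℕ.^ b ℕ.* l in
                                Λ L * Λ D ≤ Λ (D ℕ.* L) * Λ (D ℕ.* L)
    Λ-*-≤-prime-power {p} {d} {l} p-prime p∤d p∤l Λ-≤ a b = begin
      Λ L * Λ D
        ≡⟨ cong₂ _*_ (Λ-prime-power-* p-prime p∤l b) (Λ-prime-power-* p-prime p∤d a) ⟩
      (G b * Λ l) * (G a * Λ d)
        ≡⟨ rearrange (G b) (Λ l) (G a) (Λ d) ⟩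
      (G a * G b) * (Λ l * Λ d)
        ≤⟨ *-mono-≤-nonNeg (geometricSum-*-≤ (χ-sign p) a b) Λ-≤
                           (*-nonNeg G[a+b]≥0 G[a+b]≥0) (*-nonNeg (Λ-nonNeg l) (Λ-nonNeg d)) ⟩
      (G (a ℕ.+ b) * G (a ℕ.+ b)) * (Λ (d ℕ.* l) * Λ (d ℕ.* l))
        ≡⟨ ℤ-*-interchange (G (a ℕ.+ b)) (G (a ℕ.+ b)) (Λ (d ℕ.* l)) (Λ (d ℕ.* l)) ⟩
      (G (a ℕ.+ b) * Λ (d ℕ.* l)) * (G (a ℕ.+ b) * Λ (d ℕ.* l))
        ≡⟨ cong₂ _*_ Λ[DL] Λ[DL] ⟨
      Λ (D ℕ.* L) * Λ (D ℕ.* L)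
        ∎
      where
      open ℤₚ.≤-Reasoning
      instance
        d≢0 : NonZero d
        d≢0 = ∤⇒nonZero p∤d
        l≢0 : NonZero l
        l≢0 = ∤⇒nonZero p∤l
      D L : ℕ
      D = p ℕ.^ a ℕ.* d
      L = p ℕ.^ b ℕ.* l
      G : ℕ → ℤ
      G = geometricSum (χ p)
      G[a+b]≥0 : 0ℤ ≤ G (a ℕ.+ b)
      G[a+b]≥0 = geometricSum-nonNeg (χ-sign p) (a ℕ.+ b)
      Λ[DL] : Λ (D ℕ.* L) ≡ G (a ℕ.+ b) * Λ (d ℕ.* l)
      Λ[DL] = trans (cong Λ (p^a*m*[p^b*n]≡p^[a+b]*[m*n] p a b d l))
                    (Λ-prime-power-* p-prime (∤-prime-* p-prime p∤d p∤l) (a ℕ.+ b))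
      rearrange : ∀ u v w z → (u * v) * (w * z) ≡ (w * u) * (v * z)
      rearrange = solve-∀

    Λ-*-≤ : ∀ d l .{{_ : NonZero d}} .{{_ : NonZero l}} → Λ l * Λ d ≤ Λ (d ℕ.* l) * Λ (d ℕ.* l)
    Λ-*-≤ d l = go d l (<-wellFounded (d ℕ.* l))
      where
      go : ∀ d l .{{_ : NonZero d}} .{{_ : NonZero l}} → Acc ℕ._<_ (d ℕ.* l) →
           Λ l * Λ d ≤ Λ (d ℕ.* l) * Λ (d ℕ.* l)
      go d l (acc rec) with d ℕ.* l ℕ.≟ 1
      ... | yes dl≡1 rewrite ℕₚ.m*n≡1⇒m≡1 d l dl≡1 | ℕₚ.m*n≡1⇒n≡1 d l dl≡1 = ℤₚ.≤-refl
      ... | no dl≢1 with ∃-prime-∣ (d ℕ.* l) {{ℕₚ.m*n≢0 d l}} dl≢1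
      ... | p , p-prime , p∣dl with prime-power-split p-prime d | prime-power-split p-prime l
      ... | a , d′ , p∤d′ , refl | b , l′ , p∤l′ , refl =
        Λ-*-≤-prime-power p-prime p∤d′ p∤l′ (go d′ l′ (rec d′l′<dl)) a b
        where
        instance
          d′≢0 : NonZero d′
          d′≢0 = ∤⇒nonZero p∤d′
          l′≢0 : NonZero l′
          l′≢0 = ∤⇒nonZero p∤l′
        dl≡ : p ℕ.^ a ℕ.* d′ ℕ.* (p ℕ.^ b ℕ.* l′) ≡ p ℕ.^ (a ℕ.+ b) ℕ.* (d′ ℕ.* l′)
        dl≡ = p^a*m*[p^b*n]≡p^[a+b]*[m*n] p a b d′ l′
        d′l′<dl : d′ ℕ.* l′ ℕ.< p ℕ.^ a ℕ.* d′ ℕ.* (p ℕ.^ b ℕ.* l′)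
        d′l′<dl = subst (d′ ℕ.* l′ ℕ.<_) (sym dl≡)
                        (<-prime-power-* p-prime (a ℕ.+ b) {{ℕₚ.m*n≢0 d′ l′}}
                                         (∤-prime-* p-prime p∤d′ p∤l′) (subst (p ∣_) dl≡ p∣dl))

lemma13 : (q : ℕ) .{{_ : NonZero q}} (X : RealDirichletCharacter q) (d l : ℕ) → NonZero d → NonZero l → lam (RealDirichletCharacter.χ X) l * lam (RealDirichletCharacter.χ X) d ≤ lam (RealDirichletCharacter.χ X) (d ℕ.* l) * lam (RealDirichletCharacter.χ X) (d ℕ.* l)
lemma13 q X d l d≢0 l≢0 =
  subst₂ _≤_ (sym (cong₂ _*_ (lam≡divisorSum χ l) (lam≡divisorSum χ d)))
             (sym (cong₂ _*_ (lam≡divisorSum χ (d ℕ.* l)) (lam≡divisorSum χ (d ℕ.* l))))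
             (Λ-*-≤ χ mult one real d l {{d≢0}} {{l≢0}})
  where open RealDirichletCharacter X
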